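{- Let $q\geqslant2$ be an even integer and $n\geqslant1$. Then $|\mathrm{SB}^+_q(n)|=|\mathrm{SB}^-_q(n)|$.
   Context: With $\omega=e^{2\pi i/q}$ and $H_f(y)=\sum_{x\in\mathbb{F}_2^n}\omega^{f(x)}(-1)^{\langle x,y\rangle}$ for $f:\mathbb{F}_2^n\to\mathbb{Z}_q$: $\mathrm{SB}^+_q(n)$ is the set of $f$ with $H_f(y)=2^{n/2}\omega^{f(y)}$ for all $y$ (self-dual generalized bent functions), and $\mathrm{SB}^-_q(n)$ the set of $f$ with $H_f(y)=2^{n/2}\omega^{f(y)+q/2}$ for all $y$ (anti-self-dual generalized bent functions). -}

module Defs where

open import Level using (Level; _⊔_)
open import Algebra.Bundles using (CommutativeRing)
open import Data.Nat using (ℕ; zero; suc; _<_; ⌊_/2⌋) renaming (_+_ to _+ℕ_)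
open import Data.Bool using (Bool; true; false; _xor_; _∧_)
open import Data.Fin using (Fin; toℕ)
open import Data.Vec using (Vec; []; _∷_)
open import Data.Product using (Σ; _×_)
open import Data.Sum using (_⊎_)
open import Relation.Nullary using (¬_)
open import Relation.Binary.PropositionalEquality using (_≡_)

-- F_2^n is represented by Vec Bool n (false = 0, true = 1).
𝔽₂^ : ℕ → Set
𝔽₂^ n = Vec Bool n

⟨_,_⟩ : ∀ {n} → 𝔽₂^ n → 𝔽₂^ n → Bool
⟨ [] , [] ⟩ = false
⟨ a ∷ x , b ∷ y ⟩ = (a ∧ b) xor ⟨ x , y ⟩

GBF : ℕ → ℕ → Set
GBF n q = 𝔽₂^ n → Fin q

module _ {c ℓ : Level} (R : CommutativeRing c ℓ) where
  open CommutativeRing R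

  pow : Carrier → ℕ → Carrier
  pow a zero = 1#
  pow a (suc k) = a * pow a k

  natR : ℕ → Carrier
  natR zero = 0#
  natR (suc k) = 1# + natR k

  -- R is an integral domain of characteristic 0 (so R embeds in a field of char 0)
  IsIntegralDomainChar0 : Set (c ⊔ ℓ)
  IsIntegralDomainChar0 =
    (¬ (1# ≈ 0#)) ×
    ((∀ a b → a * b ≈ 0# → (a ≈ 0#) ⊎ (b ≈ 0#)) ×
     (∀ k → ¬ (natR (suc k) ≈ 0#)))

  IsPrimitiveRoot : ℕ → Carrier → Set ℓ
  IsPrimitiveRoot q ω = (pow ω q ≈ 1#) × (∀ k → 0 < k → k < q → ¬ (pow ω k ≈ 1#))

  sgn : Bool → Carrier
  sgn false = 1#
  sgn true = - 1#

  sum𝔽₂ : (n : ℕ) → (𝔽₂^ n → Carrier) → Carrier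
  sum𝔽₂ zero g = g []
  sum𝔽₂ (suc n) g = sum𝔽₂ n (λ x → g (false ∷ x)) + sum𝔽₂ n (λ x → g (true ∷ x))

  H : ∀ {n q} → Carrier → GBF n q → 𝔽₂^ n → Carrier
  H {n} ω f y = sum𝔽₂ n (λ x → pow ω (toN (f x)) * sgn ⟨ x , y ⟩)
    where toN = toℕ

  -- s plays the role of √2, so 2^{n/2} = s^n.
  -- self-dual generalized bent:  H_f(y) = 2^{n/2} ω^{f(y)}
  SBplus : ∀ {n q} → Carrier → Carrier → GBF n q → Set ℓ
  SBplus {n} ω s f = ∀ y → H ω f y ≈ pow s n * pow ω (toℕ (f y))

  SBminus : ∀ {n q} → Carrier → Carrier → GBF n q → Set ℓ
  SBminus {n} {q} ω s f = ∀ y → H ω f y ≈ pow s n * pow ω (toℕ (f y) +ℕ ⌊ q /2⌋)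

-- |{f | P f}| = |{f | Q f}| for subsets of the finite set of functions
-- A → B, functions being compared pointwise: mutually inverse maps.
record SameCard {a b p r : Level} {A : Set a} {B : Set b}
                (P : (A → B) → Set p) (Q : (A → B) → Set r) : Set (a ⊔ b ⊔ p ⊔ r) where
  field
    to       : (f : A → B) → P f → A → B
    to-in    : (f : A → B) (pf : P f) → Q (to f pf)
    from     : (g : A → B) → Q g → A → B
    from-in  : (g : A → B) (qg : Q g) → P (from g qg)
    from-to  : (f : A → B) (pf : P f) → ∀ x → from (to f pf) (to-in f pf) x ≡ f x
    to-from  : (g : A → B) (qg : Q g) → ∀ x → to (from g qg) (from-in g qg) x ≡ g x

{-# OPTIONS --safe #-}
module Submission where

-- Split x ∈ 𝔽₂^{n+1} as (b, x′) and put g(b, x′) = f(b+1, x′) + (q/2)(b+c). Since ω^{q/2} = -1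
-- (ω is primitive of even order in a domain), ω^g is ω^f translated by e₁ and multiplied by the
-- character ±(-1)^{x₁}, and the Walsh transform exchanges the two: H_g(d, y′) = ±(-1)^{d+1} H_f(d+1, y′).
-- With c = 0 this sends SB⁺ to SB⁻, with c = 1 it sends SB⁻ to SB⁺, and the two maps are mutually
-- inverse because adding q/2 twice is a full turn.

open import Defs
open import Level using (Level; _⊔_)
open import Algebra.Bundles using (CommutativeRing)
open import Data.Bool using (Bool; true; false; not; _xor_; _∧_)
open import Data.Empty using (⊥-elim)
open import Data.Bool.Properties using (not-distribˡ-xor)
open import Data.Fin using (Fin; toℕ)
open import Data.Fin.Properties using (toℕ-fromℕ<; toℕ-injective; toℕ<n)
open import Data.Nat as Nat using (ℕ; zero; suc; NonZero; >-nonZero⁻¹; _≤_; ⌊_/2⌋)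
open import Data.Nat.Divisibility using (_∣_; _∣0; ∣-refl)
open import Data.Nat.DivMod
  using (_%_; _/_; _mod_; m%n<n; m≡m%n+[m/n]*n; %-distribˡ-+; m%n%n≡m%n; %-remove-+ʳ; m<n⇒m%n≡m)
import Data.Nat.Properties as Natₚ
open import Data.Product using (proj₁; proj₂)
open import Data.Sum using (_⊎_; inj₁; inj₂)
open import Data.Vec using ([]; _∷_; head)
open import Relation.Binary.PropositionalEquality using (_≡_)
import Relation.Binary.PropositionalEquality as ≡

⌊2*n/2⌋≡n : ∀ n → ⌊ 2 Nat.* n /2⌋ ≡ n
⌊2*n/2⌋≡n zero    = ≡.refl
⌊2*n/2⌋≡n (suc n) rewrite Natₚ.+-suc n (n Nat.+ 0) = ≡.cong suc (⌊2*n/2⌋≡n n)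

module ℤMod (q : ℕ) .{{_ : NonZero q}} where

  open Nat using (_+_)
  open ≡.≡-Reasoning

  infixl 6 _⊕_
  _⊕_ : Fin q → ℕ → Fin q
  i ⊕ k = (toℕ i + k) mod q

  toℕ-⊕ : ∀ i k → toℕ (i ⊕ k) ≡ (toℕ i + k) % q
  toℕ-⊕ i k = toℕ-fromℕ< (m%n<n (toℕ i + k) q)

  [m%q+k]%q≡[m+k]%q : ∀ a k → (a % q + k) % q ≡ (a + k) % q
  [m%q+k]%q≡[m+k]%q a k = begin
    (a % q + k) % q          ≡⟨ %-distribˡ-+ (a % q) k q ⟩
    (a % q % q + k % q) % q  ≡⟨ ≡.cong (λ r → (r + k % q) % q) (m%n%n≡m%n a q) ⟩
    (a % q + k % q) % q      ≡⟨ %-distribˡ-+ a k q ⟨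
    (a + k) % q              ∎

  ⊕-⊕ : ∀ i j k → i ⊕ j ⊕ k ≡ i ⊕ (j + k)
  ⊕-⊕ i j k = toℕ-injective (begin
    toℕ (i ⊕ j ⊕ k)             ≡⟨ toℕ-⊕ (i ⊕ j) k ⟩
    (toℕ (i ⊕ j) + k) % q       ≡⟨ ≡.cong (λ r → (r + k) % q) (toℕ-⊕ i j) ⟩
    ((toℕ i + j) % q + k) % q   ≡⟨ [m%q+k]%q≡[m+k]%q (toℕ i + j) k ⟩
    (toℕ i + j + k) % q         ≡⟨ ≡.cong (_% q) (Natₚ.+-assoc (toℕ i) j k) ⟩
    (toℕ i + (j + k)) % q       ≡⟨ toℕ-⊕ i (j + k) ⟨
    toℕ (i ⊕ (j + k))           ∎)

  ⊕-multiple : ∀ i {k} → q ∣ k → i ⊕ k ≡ i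
  ⊕-multiple i {k} q∣k = toℕ-injective (begin
    toℕ (i ⊕ k)       ≡⟨ toℕ-⊕ i k ⟩
    (toℕ i + k) % q   ≡⟨ %-remove-+ʳ (toℕ i) q∣k ⟩
    toℕ i % q         ≡⟨ m<n⇒m%n≡m (toℕ<n i) ⟩
    toℕ i             ∎)

flipHead : ∀ {n} → 𝔽₂^ (suc n) → 𝔽₂^ (suc n)
flipHead (b ∷ x) = not b ∷ x

module RingFacts {c ℓ : Level} (R : CommutativeRing c ℓ) where

  open CommutativeRing R
  open import Algebra.Properties.Ring ring using (-1*x≈-x; -‿involutive; -‿distribˡ-*; -‿distribʳ-*)
  open import Algebra.Properties.Group +-group using (inverseˡ-unique; x∙y⁻¹≈ε⇒x≈y)
  open import Algebra.Solver.Ring.NaturalCoefficients.Default commutativeSemiring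
  open import Relation.Binary.Reasoning.Setoid setoid

  NoZeroDivisors : Set (c ⊔ ℓ)
  NoZeroDivisors = ∀ a b → a * b ≈ 0# → a ≈ 0# ⊎ b ≈ 0#

  x*x≈1⇒[x-1][x+1]≈0 : ∀ x → x * x ≈ 1# → (x + - 1#) * (x + 1#) ≈ 0#
  x*x≈1⇒[x-1][x+1]≈0 x x²≈1 = begin
    (x + - 1#) * (x + 1#)          ≈⟨ solve 2 (λ x u → (x :+ u) :* (x :+ con 1) := x :* x :+ (x :+ u :* x) :+ u) refl x (- 1#) ⟩
    x * x + (x + - 1# * x) + - 1#  ≈⟨ +-congʳ (+-cong x²≈1 (+-congˡ (-1*x≈-x x))) ⟩
    1# + (x + - x) + - 1#          ≈⟨ +-congʳ (+-congˡ (-‿inverseʳ x)) ⟩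
    1# + 0# + - 1#                 ≈⟨ +-congʳ (+-identityʳ 1#) ⟩
    1# + - 1#                      ≈⟨ -‿inverseʳ 1# ⟩
    0#                             ∎

  x*x≈1⇒x≈1⊎x≈-1 : NoZeroDivisors → ∀ x → x * x ≈ 1# → x ≈ 1# ⊎ x ≈ - 1#
  x*x≈1⇒x≈1⊎x≈-1 noZeroDivisors x x²≈1
    with noZeroDivisors (x + - 1#) (x + 1#) (x*x≈1⇒[x-1][x+1]≈0 x x²≈1)
  ... | inj₁ x-1≈0 = inj₁ (x∙y⁻¹≈ε⇒x≈y x 1# x-1≈0)
  ... | inj₂ x+1≈0 = inj₂ (inverseˡ-unique x 1# x+1≈0)

  sgn-not : ∀ b → sgn R (not b) ≈ - sgn R b
  sgn-not false = refl
  sgn-not true  = sym (-‿involutive 1#)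

  sgn-xor : ∀ b b′ → sgn R (b xor b′) ≈ sgn R b * sgn R b′
  sgn-xor false b′ = sym (*-identityˡ _)
  sgn-xor true  b′ = trans (sgn-not b′) (sym (-1*x≈-x _))

  sgn-square : ∀ b → sgn R b * sgn R b ≈ 1#
  sgn-square false = *-identityˡ 1#
  sgn-square true  = trans (-1*x≈-x (- 1#)) (-‿involutive 1#)

  sgn-not-swap : ∀ b b′ → sgn R (not b) * sgn R b′ ≈ sgn R b * sgn R (not b′)
  sgn-not-swap b b′ = begin
    sgn R (not b) * sgn R b′ ≈⟨ *-congʳ (sgn-not b) ⟩
    - sgn R b * sgn R b′     ≈⟨ -‿distribˡ-* _ _ ⟨
    - (sgn R b * sgn R b′)   ≈⟨ -‿distribʳ-* _ _ ⟩
    sgn R b * - sgn R b′     ≈⟨ *-congˡ (sgn-not b′) ⟨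
    sgn R b * sgn R (not b′) ∎

  sgn-modulate : ∀ b d t → sgn R b * sgn R ((b ∧ d) xor t) ≈ sgn R ((b ∧ not d) xor t)
  sgn-modulate false d t = *-identityˡ _
  sgn-modulate true  d t = begin
    - 1# * sgn R (d xor t)     ≈⟨ -1*x≈-x _ ⟩
    - sgn R (d xor t)          ≈⟨ sgn-not (d xor t) ⟨
    sgn R (not (d xor t))      ≡⟨ ≡.cong (sgn R) (not-distribˡ-xor d t) ⟩
    sgn R (not d xor t)        ∎

  sum𝔽₂-cong : ∀ n {g h : 𝔽₂^ n → Carrier} → (∀ x → g x ≈ h x) → sum𝔽₂ R n g ≈ sum𝔽₂ R n h
  sum𝔽₂-cong zero    g≈h = g≈h []
  sum𝔽₂-cong (suc n) g≈h =
    +-cong (sum𝔽₂-cong n (λ x → g≈h (false ∷ x))) (sum𝔽₂-cong n (λ x → g≈h (true ∷ x)))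

  sum𝔽₂-*ˡ : ∀ n k (g : 𝔽₂^ n → Carrier) → sum𝔽₂ R n (λ x → k * g x) ≈ k * sum𝔽₂ R n g
  sum𝔽₂-*ˡ zero    k g = refl
  sum𝔽₂-*ˡ (suc n) k g = trans (+-cong (sum𝔽₂-*ˡ n k _) (sum𝔽₂-*ˡ n k _)) (sym (distribˡ k _ _))

  pow-+ : ∀ x a b → pow R x (a Nat.+ b) ≈ pow R x a * pow R x b
  pow-+ x zero    b = sym (*-identityˡ _)
  pow-+ x (suc a) b = trans (*-congˡ (pow-+ x a b)) (sym (*-assoc _ _ _))

  pow-*≈1 : ∀ {x} q → pow R x q ≈ 1# → ∀ j → pow R x (j Nat.* q) ≈ 1#
  pow-*≈1 q x^q≈1 zero    = refl
  pow-*≈1 q x^q≈1 (suc j) =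
    trans (pow-+ _ q (j Nat.* q)) (trans (*-cong x^q≈1 (pow-*≈1 q x^q≈1 j)) (*-identityˡ 1#))

  pow-% : ∀ {x} q .{{_ : NonZero q}} → pow R x q ≈ 1# → ∀ k → pow R x (k % q) ≈ pow R x k
  pow-% {x} q x^q≈1 k = sym (begin
    pow R x k                                    ≡⟨ ≡.cong (pow R x) (m≡m%n+[m/n]*n k q) ⟩
    pow R x (k % q Nat.+ (k / q) Nat.* q)        ≈⟨ pow-+ x (k % q) _ ⟩
    pow R x (k % q) * pow R x ((k / q) Nat.* q)  ≈⟨ *-congˡ (pow-*≈1 q x^q≈1 (k / q)) ⟩
    pow R x (k % q) * 1#                         ≈⟨ *-identityʳ _ ⟩
    pow R x (k % q)                              ∎)

  -- H R ω f is definitionally walsh (λ x → pow R ω (toℕ (f x))).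
  walsh : ∀ {n} → (𝔽₂^ n → Carrier) → 𝔽₂^ n → Carrier
  walsh {n} φ y = sum𝔽₂ R n (λ x → φ x * sgn R ⟨ x , y ⟩)

  walsh-cong : ∀ {n} {φ ψ : 𝔽₂^ n → Carrier} → (∀ x → φ x ≈ ψ x) → ∀ y → walsh φ y ≈ walsh ψ y
  walsh-cong {n} φ≈ψ y = sum𝔽₂-cong n (λ x → *-congʳ (φ≈ψ x))

  walsh-*ˡ : ∀ {n} k (φ : 𝔽₂^ n → Carrier) y → walsh (λ x → k * φ x) y ≈ k * walsh φ y
  walsh-*ˡ {n} k φ y = trans (sum𝔽₂-cong n (λ x → *-assoc k (φ x) _)) (sum𝔽₂-*ˡ n k _)

  walsh-∷ : ∀ {n} (φ : 𝔽₂^ (suc n) → Carrier) d y →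
            walsh φ (d ∷ y) ≈ walsh (λ x → φ (false ∷ x)) y + sgn R d * walsh (λ x → φ (true ∷ x)) y
  walsh-∷ {n} φ d y = +-congˡ (trans (sum𝔽₂-cong n split-sign) (sum𝔽₂-*ˡ n (sgn R d) _))
    where
    split-sign : ∀ x → φ (true ∷ x) * sgn R (d xor ⟨ x , y ⟩) ≈ sgn R d * (φ (true ∷ x) * sgn R ⟨ x , y ⟩)
    split-sign x = trans (*-congˡ (sgn-xor d _))
      (solve 3 (λ p a b → p :* (a :* b) := a :* (p :* b)) refl (φ (true ∷ x)) (sgn R d) _)

  walsh-flipHead : ∀ {n} (φ : 𝔽₂^ (suc n) → Carrier) d y →
                   walsh (λ x → φ (flipHead x)) (d ∷ y) ≈ sgn R d * walsh φ (d ∷ y)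
  walsh-flipHead φ d y = begin
    walsh (λ x → φ (flipHead x)) (d ∷ y) ≈⟨ walsh-∷ (λ x → φ (flipHead x)) d y ⟩
    A₁ + v * A₀                          ≈⟨ solve 3 (λ v a₀ a₁ → a₁ :+ v :* a₀ := v :* a₀ :+ a₁) refl v A₀ A₁ ⟩
    v * A₀ + A₁                          ≈⟨ +-congˡ (*-identityˡ A₁) ⟨
    v * A₀ + 1# * A₁                     ≈⟨ +-congˡ (*-congʳ (sgn-square d)) ⟨
    v * A₀ + (v * v) * A₁                ≈⟨ solve 3 (λ v a₀ a₁ → v :* a₀ :+ (v :* v) :* a₁ := v :* (a₀ :+ v :* a₁)) refl v A₀ A₁ ⟩
    v * (A₀ + v * A₁)                    ≈⟨ *-congˡ (walsh-∷ φ d y) ⟨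
    v * walsh φ (d ∷ y)                  ∎
    where
    v = sgn R d
    A₀ = walsh (λ x → φ (false ∷ x)) y
    A₁ = walsh (λ x → φ (true ∷ x)) y

  walsh-modulate : ∀ {n} (φ : 𝔽₂^ (suc n) → Carrier) d y →
                   walsh (λ x → sgn R (head x) * φ x) (d ∷ y) ≈ walsh φ (not d ∷ y)
  walsh-modulate {n} φ d y = sum𝔽₂-cong (suc n) modulate
    where
    modulate : ∀ x → (sgn R (head x) * φ x) * sgn R ⟨ x , d ∷ y ⟩ ≈ φ x * sgn R ⟨ x , not d ∷ y ⟩
    modulate (b ∷ x) = trans
      (solve 3 (λ s p t → (s :* p) :* t := p :* (s :* t)) refl (sgn R b) (φ (b ∷ x)) _)
      (*-congˡ (sgn-modulate b d ⟨ x , y ⟩))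

module EvenOrderRoot {c ℓ : Level} (R : CommutativeRing c ℓ)
  (noZeroDivisors : RingFacts.NoZeroDivisors R)
  (m : ℕ) .{{_ : NonZero m}} (ω s : CommutativeRing.Carrier R)
  (ω-primitive : IsPrimitiveRoot R (2 Nat.* m) ω) where

  open CommutativeRing R
  open RingFacts R
  open import Algebra.Solver.Ring.NaturalCoefficients.Default commutativeSemiring
  open import Relation.Binary.Reasoning.Setoid setoid

  q : ℕ
  q = 2 Nat.* m

  instance
    q≢0 : NonZero q
    q≢0 = Natₚ.m*n≢0 2 m

  open ℤMod q

  ω^ : Fin q → Carrier
  ω^ i = pow R ω (toℕ i)

  m+m≡q : m Nat.+ m ≡ q
  m+m≡q = ≡.cong (m Nat.+_) (≡.sym (Natₚ.+-identityʳ m))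

  m<q : m Nat.< q
  m<q = ≡.subst (m Nat.<_) m+m≡q (Natₚ.m<m+n m (>-nonZero⁻¹ m))

  ω^m*ω^m≈1 : pow R ω m * pow R ω m ≈ 1#
  ω^m*ω^m≈1 = trans (sym (pow-+ ω m m)) (trans (reflexive (≡.cong (pow R ω) m+m≡q)) (proj₁ ω-primitive))

  ω^m≈-1 : pow R ω m ≈ - 1#
  ω^m≈-1 with x*x≈1⇒x≈1⊎x≈-1 noZeroDivisors (pow R ω m) ω^m*ω^m≈1
  ... | inj₁ ω^m≈1  = ⊥-elim (proj₂ ω-primitive m (>-nonZero⁻¹ m) m<q ω^m≈1)
  ... | inj₂ x≈-1   = x≈-1

  pow-⊕ : ∀ i k → ω^ (i ⊕ k) ≈ ω^ i * pow R ω k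
  pow-⊕ i k = begin
    pow R ω (toℕ (i ⊕ k))           ≡⟨ ≡.cong (pow R ω) (toℕ-⊕ i k) ⟩
    pow R ω ((toℕ i Nat.+ k) % q)   ≈⟨ pow-% q (proj₁ ω-primitive) (toℕ i Nat.+ k) ⟩
    pow R ω (toℕ i Nat.+ k)         ≈⟨ pow-+ ω (toℕ i) k ⟩
    ω^ i * pow R ω k                ∎

  halfTurn : Bool → ℕ
  halfTurn false = 0
  halfTurn true  = m

  pow-halfTurn : ∀ b → pow R ω (halfTurn b) ≈ sgn R b
  pow-halfTurn false = refl
  pow-halfTurn true  = ω^m≈-1

  ⊕-halfTurn-involutive : ∀ i b → i ⊕ halfTurn b ⊕ halfTurn b ≡ i
  ⊕-halfTurn-involutive i b = ≡.trans (⊕-⊕ i (halfTurn b) (halfTurn b)) (⊕-multiple i (q∣twice b))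
    where
    q∣twice : ∀ b → q ∣ halfTurn b Nat.+ halfTurn b
    q∣twice false = q ∣0
    q∣twice true  = ≡.subst (q ∣_) (≡.sym m+m≡q) ∣-refl

  pow-half-shift : ∀ i → pow R ω (i Nat.+ ⌊ q /2⌋) ≈ pow R ω i * - 1#
  pow-half-shift i rewrite ⌊2*n/2⌋≡n m = trans (pow-+ ω i m) (*-congˡ ω^m≈-1)

  flipShift : ∀ {n} → Bool → GBF (suc n) q → GBF (suc n) q
  flipShift c f x = f (flipHead x) ⊕ halfTurn (c xor head x)

  flipShift-inverse : ∀ {n} c (f : GBF (suc n) q) x → flipShift (not c) (flipShift c f) x ≡ f x
  flipShift-inverse false f (false ∷ x) = ⊕-halfTurn-involutive _ true
  flipShift-inverse false f (true  ∷ x) = ⊕-halfTurn-involutive _ false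
  flipShift-inverse true  f (false ∷ x) = ⊕-halfTurn-involutive _ false
  flipShift-inverse true  f (true  ∷ x) = ⊕-halfTurn-involutive _ true

  pow-flipShift : ∀ {n} c (f : GBF (suc n) q) x →
                  ω^ (flipShift c f x) ≈ sgn R c * (sgn R (head x) * ω^ (f (flipHead x)))
  pow-flipShift c f x = begin
    ω^ (f (flipHead x) ⊕ halfTurn (c xor b))  ≈⟨ pow-⊕ (f (flipHead x)) _ ⟩
    P * pow R ω (halfTurn (c xor b))           ≈⟨ *-congˡ (trans (pow-halfTurn (c xor b)) (sgn-xor c b)) ⟩
    P * (sgn R c * sgn R b)                    ≈⟨ solve 3 (λ p u v → p :* (u :* v) := u :* (v :* p)) refl P (sgn R c) (sgn R b) ⟩
    sgn R c * (sgn R b * P)                    ∎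
    where
    b = head x
    P = ω^ (f (flipHead x))

  walsh-flipShift : ∀ {n} c (f : GBF (suc n) q) d y →
                    H R ω (flipShift c f) (d ∷ y) ≈ sgn R c * (sgn R (not d) * H R ω f (not d ∷ y))
  walsh-flipShift c f d y = begin
    walsh (λ x → ω^ (flipShift c f x)) (d ∷ y)                           ≈⟨ walsh-cong (pow-flipShift c f) (d ∷ y) ⟩
    walsh (λ x → sgn R c * (sgn R (head x) * ψ (flipHead x))) (d ∷ y)   ≈⟨ walsh-*ˡ (sgn R c) (λ x → sgn R (head x) * ψ (flipHead x)) (d ∷ y) ⟩
    sgn R c * walsh (λ x → sgn R (head x) * ψ (flipHead x)) (d ∷ y)     ≈⟨ *-congˡ (walsh-modulate (λ x → ψ (flipHead x)) d y) ⟩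
    sgn R c * walsh (λ x → ψ (flipHead x)) (not d ∷ y)                  ≈⟨ *-congˡ (walsh-flipHead ψ (not d) y) ⟩
    sgn R c * (sgn R (not d) * walsh ψ (not d ∷ y))                     ∎
    where
    ψ = λ x → ω^ (f x)

  -- SB false is SB⁺ and SB true is SB⁻, with ω^{q/2} = -1 already applied.
  SB : ∀ {n} → Bool → GBF n q → Set ℓ
  SB {n} c f = ∀ y → H R ω f y ≈ pow R s n * (ω^ (f y) * sgn R c)

  flipShift-SB : ∀ {n} c (f : GBF (suc n) q) → SB c f → SB (not c) (flipShift c f)
  flipShift-SB {n} c f sb (d ∷ y) = begin
    H R ω (flipShift c f) (d ∷ y)                      ≈⟨ walsh-flipShift c f d y ⟩
    sgn R c * (sgn R (not d) * H R ω f (not d ∷ y))    ≈⟨ *-congˡ (*-congˡ (sb (not d ∷ y))) ⟩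
    sgn R c * (sgn R (not d) * (S * (P * sgn R c)))    ≈⟨ solve 4 (λ u v S P → u :* (v :* (S :* (P :* u))) := S :* (P :* (u :* (v :* u)))) refl (sgn R c) (sgn R (not d)) S P ⟩
    S * (P * (sgn R c * (sgn R (not d) * sgn R c)))    ≈⟨ *-congˡ (*-congˡ (*-congˡ (sgn-not-swap d c))) ⟩
    S * (P * (sgn R c * (sgn R d * sgn R (not c))))    ≈⟨ solve 5 (λ u v w S P → S :* (P :* (u :* (v :* w))) := S :* ((u :* (v :* P)) :* w)) refl (sgn R c) (sgn R d) (sgn R (not c)) S P ⟩
    S * ((sgn R c * (sgn R d * P)) * sgn R (not c))    ≈⟨ *-congˡ (*-congʳ (pow-flipShift c f (d ∷ y))) ⟨
    S * (ω^ (flipShift c f (d ∷ y)) * sgn R (not c))   ∎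
    where
    S = pow R s (suc n)
    P = ω^ (f (not d ∷ y))

  SBplus⇒SB : ∀ {n} {f : GBF n q} → SBplus R ω s f → SB false f
  SBplus⇒SB sb y = trans (sb y) (*-congˡ (sym (*-identityʳ _)))

  SB⇒SBplus : ∀ {n} {f : GBF n q} → SB false f → SBplus R ω s f
  SB⇒SBplus sb y = trans (sb y) (*-congˡ (*-identityʳ _))

  SBminus⇒SB : ∀ {n} {f : GBF n q} → SBminus R ω s f → SB true f
  SBminus⇒SB {f = f} sb y = trans (sb y) (*-congˡ (pow-half-shift (toℕ (f y))))

  SB⇒SBminus : ∀ {n} {f : GBF n q} → SB true f → SBminus R ω s f
  SB⇒SBminus {f = f} sb y = trans (sb y) (*-congˡ (sym (pow-half-shift (toℕ (f y)))))

  |SB⁺|≡|SB⁻| : ∀ n → SameCard {A = 𝔽₂^ (suc n)} (SBplus R {suc n} {q} ω s) (SBminus R ω s)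
  |SB⁺|≡|SB⁻| n = record
    { to      = λ f _ → flipShift false f
    ; to-in   = λ f sb → SB⇒SBminus {f = flipShift false f} (flipShift-SB false f (SBplus⇒SB {f = f} sb))
    ; from    = λ g _ → flipShift true g
    ; from-in = λ g sb → SB⇒SBplus {f = flipShift true g} (flipShift-SB true g (SBminus⇒SB {f = g} sb))
    ; from-to = λ f _ → flipShift-inverse false f
    ; to-from = λ g _ → flipShift-inverse true g
    }

-- Imported only here: above, _*_ is the ring multiplication.
open import Data.Nat using (_*_)

corollary3 : {c ℓ : Level} (R : CommutativeRing c ℓ) →
    IsIntegralDomainChar0 R →
    (q n : ℕ) → 2 ≤ q → (m : ℕ) → q ≡ 2 * m → 1 ≤ n →
    (ω s : CommutativeRing.Carrier R) →
    IsPrimitiveRoot R q ω →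
    CommutativeRing._≈_ R (CommutativeRing._*_ R s s)
    (CommutativeRing._+_ R (CommutativeRing.1# R) (CommutativeRing.1# R)) →
    SameCard {A = 𝔽₂^ n} {B = _} (SBplus R {n} {q} ω s) (SBminus R {n} {q} ω s)
corollary3 R integralDomain .(2 * suc m) (suc n) _ (suc m) ≡.refl _ ω s ω-primitive _ =
  EvenOrderRoot.|SB⁺|≡|SB⁻| R (proj₁ (proj₂ integralDomain)) (suc m) ω s ω-primitive n
corollary3 R _ .(2 * 0) _ () zero ≡.refl _ _ _ _ _
corollary3 R _ _ zero _ _ _ () _ _ _ _
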